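{- Let $F:\mathbf{Set}\to\mathbf{Set}$ be a functor that is a coproduct of covariant hom functors, i.e. there is a non-empty family of sets $(X_i)_{i\in I}$ with $F=\coprod_{i\in I}\hom(X_i,-)$. Then the set of natural transformations $F\times F\to F$ is in bijection with $\prod_{i,j\in I}F(X_i+X_j)$: \[ [\mathbf{Set},\mathbf{Set}](F\times F,F)\cong\prod_{i,j\in I}F(X_i+X_j). \]
   Context: $F\times F$ denotes the pointwise product functor $X\mapsto FX\times FX$, and $X_i+X_j$ the disjoint union (coproduct) of sets. -}

module Defs where

open import Level using (Level; 0ℓ) renaming (suc to lsuc)
open import Data.Product using (Σ; _×_; _,_; proj₁; proj₂)
open import Data.Sum using (_⊎_)
open import Function using (_∘_)
open import Relation.Binary.Bundles using (Setoid)
open import Relation.Binary.Structures using (IsEquivalence)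
open import Relation.Binary.PropositionalEquality
  using (_≡_; refl; sym; trans; cong; subst)

module _ (I : Set) (X : I → Set) where

  Fob : Set → Set
  Fob Y = Σ I (λ i → X i → Y)

  Fmap : {Y Z : Set} → (Y → Z) → Fob Y → Fob Z
  Fmap h (i , f) = i , h ∘ f

  -- Equality of elements of F Y: same summand and pointwise-equal maps
  -- (the extensional equality of the set F Y; Agda has no funext).
  record _≈F_ {Y : Set} (a b : Fob Y) : Set where
    constructor _,_
    field
      summand : proj₁ a ≡ proj₁ b
      pointwise : ∀ x → proj₂ a x ≡ proj₂ b (subst X summand x)

  ≈F-refl : {Y : Set} {a : Fob Y} → a ≈F a
  ≈F-refl {a = a} = refl , λ x → refl

  ≈F-sym : {Y : Set} {a b : Fob Y} → a ≈F b → b ≈F a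
  ≈F-sym {a = i , f} {b = .i , g} (refl , e) = refl , λ x → sym (e x)

  ≈F-trans : {Y : Set} {a b c : Fob Y} → a ≈F b → b ≈F c → a ≈F c
  ≈F-trans {a = i , f} {b = .i , g} {c = .i , h} (refl , e) (refl , e') =
    refl , λ x → trans (e x) (e' x)

  FSetoid : Set → Setoid 0ℓ 0ℓ
  FSetoid Y = record
    { Carrier = Fob Y
    ; _≈_ = _≈F_
    ; isEquivalence = record { refl = λ {a} → ≈F-refl {a = a} ; sym = ≈F-sym ; trans = ≈F-trans }
    }

  record NatTrans : Set₁ where
    field
      η : (Y : Set) → Fob Y × Fob Y → Fob Y
      -- each component is a function of the (extensional) sets involved
      η-cong : (Y : Set) {a a' b b' : Fob Y} →
               a ≈F a' → b ≈F b' → η Y (a , b) ≈F η Y (a' , b')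
      natural : {Y Z : Set} (h : Y → Z) (a b : Fob Y) →
                η Z (Fmap h a , Fmap h b) ≈F Fmap h (η Y (a , b))
  open NatTrans public

  _≈N_ : NatTrans → NatTrans → Set₁
  α ≈N β = (Y : Set) (a b : Fob Y) → η α Y (a , b) ≈F η β Y (a , b)

  NatSetoid : Setoid (lsuc 0ℓ) (lsuc 0ℓ)
  NatSetoid = record
    { Carrier = NatTrans
    ; _≈_ = _≈N_
    ; isEquivalence = record
      { refl = λ {α} Y a b → ≈F-refl {a = η α Y (a , b)}
      ; sym = λ e Y a b → ≈F-sym (e Y a b)
      ; trans = λ e e' Y a b → ≈F-trans (e Y a b) (e' Y a b)
      }
    }

  Prod : Set
  Prod = (i j : I) → Fob (X i ⊎ X j)

  ProdSetoid : Setoid 0ℓ 0ℓ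
  ProdSetoid = record
    { Carrier = Prod
    ; _≈_ = λ c d → ∀ i j → c i j ≈F d i j
    ; isEquivalence = record
      { refl = λ {c} i j → ≈F-refl {a = c i j}
      ; sym = λ e i j → ≈F-sym (e i j)
      ; trans = λ e e' i j → ≈F-trans (e i j) (e' i j)
      }
    }

module Submission where

-- A pair of elements (i , f) , (j , g) of F Y is the image under F [ f , g ] of the
-- generic pair (i , inj₁) , (j , inj₂) in F (X i ⊎ X j). By naturality a transformation
-- F × F ⇒ F is therefore determined by its values on the generic pairs, and conversely
-- any choice of such values extends to a natural transformation: this is the Yoneda
-- lemma for the representable functors hom (X i ⊎ X j , -) ≅ hom (X i , -) × hom (X j , -).

open import Defs
open import Function.Bundles using (Inverse)
open import Data.Product using (_×_; _,_)
open import Data.Sum using (_⊎_; inj₁; inj₂; [_,_]′)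
open import Data.Sum.Properties using ([,]-∘; [,]-cong; map-id)
open import Relation.Binary.PropositionalEquality using (refl; cong; _≗_)

module _ (I : Set) (X : I → Set) where

  private
    F : Set → Set
    F = Fob I X

    _≈_ : {Y : Set} → F Y → F Y → Set
    _≈_ = _≈F_ I X

  Fmap-cong : {Y Z : Set} (h : Y → Z) {a b : F Y} → a ≈ b → Fmap I X h a ≈ Fmap I X h b
  Fmap-cong h {i , f} {.i , g} (refl , e) = refl , λ x → cong h (e x)

  Fmap-resp-≗ : {Y Z : Set} {h h′ : Y → Z} → h ≗ h′ → (a : F Y) → Fmap I X h a ≈ Fmap I X h′ a
  Fmap-resp-≗ e (i , f) = refl , λ x → e (f x)

  genericPair : (i j : I) → F (X i ⊎ X j) × F (X i ⊎ X j)
  genericPair i j = (i , inj₁) , (j , inj₂)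

  toProd : NatTrans I X → Prod I X
  toProd α i j = η α (X i ⊎ X j) (genericPair i j)

  extend : Prod I X → (Y : Set) → F Y × F Y → F Y
  extend c Y ((i , f) , (j , g)) = Fmap I X [ f , g ]′ (c i j)

  extend-cong : (c : Prod I X) (Y : Set) {a a′ b b′ : F Y} →
                a ≈ a′ → b ≈ b′ → extend c Y (a , b) ≈ extend c Y (a′ , b′)
  extend-cong c Y {i , f} {.i , f′} {j , g} {.j , g′} (refl , e₁) (refl , e₂) =
    Fmap-resp-≗ ([,]-cong e₁ e₂) (c i j)

  extend-natural : (c : Prod I X) {Y Z : Set} (h : Y → Z) (a b : F Y) →
                   extend c Z (Fmap I X h a , Fmap I X h b) ≈ Fmap I X h (extend c Y (a , b))
  extend-natural c h (i , f) (j , g) = ≈F-sym I X (Fmap-resp-≗ ([,]-∘ h) (c i j))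

  fromProd : Prod I X → NatTrans I X
  fromProd c = record
    { η = extend c
    ; η-cong = extend-cong c
    ; natural = extend-natural c
    }

  extend-resp-≈ : {c d : Prod I X} → (∀ i j → c i j ≈ d i j) →
                  (Y : Set) (a b : F Y) → extend c Y (a , b) ≈ extend d Y (a , b)
  extend-resp-≈ e Y (i , f) (j , g) = Fmap-cong [ f , g ]′ (e i j)

  toProd∘fromProd : (c : Prod I X) (i j : I) → toProd (fromProd c) i j ≈ c i j
  toProd∘fromProd c i j = Fmap-resp-≗ map-id (c i j)

  fromProd∘toProd : (α : NatTrans I X) (Y : Set) (a b : F Y) →
                    extend (toProd α) Y (a , b) ≈ η α Y (a , b)
  fromProd∘toProd α Y (i , f) (j , g) =
    ≈F-sym I X (natural α [ f , g ]′ (i , inj₁) (j , inj₂))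

theorem4p3 : (I : Set) (X : I → Set) → I →
    Inverse (NatSetoid I X) (ProdSetoid I X)
theorem4p3 I X _ = record
  { to = toProd I X
  ; from = fromProd I X
  ; to-cong = λ e i j → e (X i ⊎ X j) _ _
  ; from-cong = extend-resp-≈ I X
  ; inverse =
      (λ {c} e i j → ≈F-trans I X (e (X i ⊎ X j) _ _) (toProd∘fromProd I X c i j))
    , (λ {α} e Y a b → ≈F-trans I X (extend-resp-≈ I X e Y a b) (fromProd∘toProd I X α Y a b))
  }
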